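{- Let $G$ be a graph with two vertices $u$ and $v$ such that $|N(u)|-1=|N(v)|$. If $G$ has a unique vertex $x$ with $x\in N(u)$ and $x\notin N(v)$, then $G$ is not group vertex magic.
   Context: Graphs are finite, simple and undirected; $N(v)$ is the open neighborhood of $v$; in this part of the paper all Abelian groups are finite. For an additive Abelian group $\Gamma$ with identity $0$ and a graph $G$, a $\Gamma$-vertex magic labeling is a map $\ell:V(G)\to\Gamma\setminus\{0\}$ for which there is $\mu\in\Gamma$ with $w(v)=\sum_{y\in N(v)}\ell(y)=\mu$ for every vertex $v$; $G$ is group vertex magic if it is $\Gamma$-vertex magic for every nontrivial Abelian group $\Gamma$. -}

module Defs where

open import Level using (0ℓ)
open import Data.Nat using (ℕ)
open import Data.Fin using (Fin)
open import Data.List using (List; filter; map; foldr; length; allFin)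
open import Data.Product using (Σ; ∃; _×_)
open import Relation.Nullary using (¬_; Dec)
open import Relation.Binary.PropositionalEquality using (_≡_)
open import Algebra.Bundles using (AbelianGroup)

record Graph (n : ℕ) : Set₁ where
  field
    Adj     : Fin n → Fin n → Set
    adj?    : ∀ x y → Dec (Adj x y)
    sym     : ∀ {x y} → Adj x y → Adj y x
    irrefl  : ∀ x → ¬ Adj x x

module _ {n : ℕ} (G : Graph n) where
  open Graph G

  N : Fin n → List (Fin n)
  N v = filter (adj? v) (allFin n)

  deg : Fin n → ℕ
  deg v = length (N v)

Finite : AbelianGroup 0ℓ 0ℓ → Set
Finite Γ = ∃ λ (k : ℕ) → Σ (Fin k → Carrier) λ f → ∀ a → ∃ λ i → f i ≈ a
  where open AbelianGroup Γ

Nontrivial : AbelianGroup 0ℓ 0ℓ → Set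
Nontrivial Γ = ∃ λ a → ¬ (a ≈ ε)
  where open AbelianGroup Γ

module _ {n : ℕ} (G : Graph n) (Γ : AbelianGroup 0ℓ 0ℓ) where
  open AbelianGroup Γ

  weight : (Fin n → Carrier) → Fin n → Carrier
  weight ℓ v = foldr _∙_ ε (map ℓ (N G v))

  IsVertexMagicLabeling : (Fin n → Carrier) → Set
  IsVertexMagicLabeling ℓ =
    (∀ v → ¬ (ℓ v ≈ ε)) × ∃ λ μ → ∀ v → weight ℓ v ≈ μ

  VertexMagic : Set
  VertexMagic = ∃ λ ℓ → IsVertexMagicLabeling ℓ

GroupVertexMagic : {n : ℕ} → Graph n → Set₁
GroupVertexMagic G =
  (Γ : AbelianGroup 0ℓ 0ℓ) → Finite Γ → Nontrivial Γ → VertexMagic G Γ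

-- Over ℤ₂ the only nonzero label is 1, so a ℤ₂-vertex magic labeling is
-- constant and the weight of a vertex is the parity of its degree: magic
-- forces all degrees to have the same parity. Since x ∈ N(u), the hypothesis
-- |N(u)| - 1 = |N(v)| says deg u = deg v + 1, a parity clash.
module Submission where

open import Defs
open import Level using (0ℓ)
open import Algebra.Bundles using (AbelianGroup)
open import Data.Nat using (ℕ; suc; _∸_)
open import Data.Nat.Base using (parity)
open import Data.Fin using (Fin; zero; suc)
open import Data.Parity.Base using (Parity; 0ℙ; 1ℙ; _+_)
open import Data.Parity.Properties using (+-0-abelianGroup; +-homo-+; p≢p⁻¹)
open import Data.List using (List; []; _∷_; map; foldr; length)
open import Data.List.Membership.Propositional using (_∈_)
open import Data.List.Membership.Propositional.Properties using (∈-filter⁺; ∈-allFin)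
open import Data.List.Relation.Unary.Any using (here; there)
open import Data.Product using (∃; _×_; _,_)
open import Relation.Nullary using (¬_)
open import Relation.Binary.PropositionalEquality
  using (_≡_; _≢_; refl; sym; trans; cong; module ≡-Reasoning)

ℤ₂ : AbelianGroup 0ℓ 0ℓ
ℤ₂ = +-0-abelianGroup

ℤ₂-finite : Finite ℤ₂
ℤ₂-finite = 2 , (λ { zero → 0ℙ ; (suc _) → 1ℙ }) ,
  λ { 0ℙ → zero , refl ; 1ℙ → suc zero , refl }

ℤ₂-nontrivial : Nontrivial ℤ₂
ℤ₂-nontrivial = 1ℙ , λ ()

parity-suc≢parity : ∀ n → parity (suc n) ≢ parity n
parity-suc≢parity n eq = p≢p⁻¹ (parity n) (sym (trans (sym (+-homo-+ 1 n)) eq))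

≢0ℙ⇒≡1ℙ : ∀ {p} → p ≢ 0ℙ → p ≡ 1ℙ
≢0ℙ⇒≡1ℙ {0ℙ} p≢0 with () ← p≢0 refl
≢0ℙ⇒≡1ℙ {1ℙ} _  = refl

sum-of-nonzero≡parity-length : {A : Set} (ℓ : A → Parity) → (∀ a → ℓ a ≢ 0ℙ) →
  ∀ xs → foldr _+_ 0ℙ (map ℓ xs) ≡ parity (length xs)
sum-of-nonzero≡parity-length ℓ ℓ≢0 []       = refl
sum-of-nonzero≡parity-length ℓ ℓ≢0 (a ∷ xs) = begin
  ℓ a + foldr _+_ 0ℙ (map ℓ xs) ≡⟨ cong (_+ foldr _+_ 0ℙ (map ℓ xs)) (≢0ℙ⇒≡1ℙ (ℓ≢0 a)) ⟩
  1ℙ + foldr _+_ 0ℙ (map ℓ xs)  ≡⟨ cong (1ℙ +_) (sum-of-nonzero≡parity-length ℓ ℓ≢0 xs) ⟩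
  1ℙ + parity (length xs)       ≡⟨ sym (+-homo-+ 1 (length xs)) ⟩
  parity (suc (length xs))      ∎
  where open ≡-Reasoning

ℤ₂-vertexMagic⇒parity-deg-equal : {n : ℕ} (G : Graph n) → VertexMagic G ℤ₂ →
  ∀ u v → parity (deg G u) ≡ parity (deg G v)
ℤ₂-vertexMagic⇒parity-deg-equal G (ℓ , ℓ≢0 , μ , weight≡μ) u v = begin
  parity (deg G u)   ≡⟨ sym (sum-of-nonzero≡parity-length ℓ ℓ≢0 (N G u)) ⟩
  weight G ℤ₂ ℓ u    ≡⟨ trans (weight≡μ u) (sym (weight≡μ v)) ⟩
  weight G ℤ₂ ℓ v    ≡⟨ sum-of-nonzero≡parity-length ℓ ℓ≢0 (N G v) ⟩
  parity (deg G v)   ∎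
  where open ≡-Reasoning

∈⇒length≡suc : {A : Set} {x : A} {xs : List A} → x ∈ xs → length xs ≡ suc (length xs ∸ 1)
∈⇒length≡suc (here _)  = refl
∈⇒length≡suc (there _) = refl

neighbour⇒deg≡suc : {n : ℕ} (G : Graph n) {u x : Fin n} →
  Graph.Adj G u x → deg G u ≡ suc (deg G u ∸ 1)
neighbour⇒deg≡suc G {u} {x} u~x = ∈⇒length≡suc (∈-filter⁺ (Graph.adj? G u) (∈-allFin x) u~x)

theorem2p2 : {n : ℕ} (G : Graph n) (u v : Fin n) →
    deg G u ∸ 1 ≡ deg G v →
    (∃ λ x → (Graph.Adj G u x × ¬ Graph.Adj G v x) ×
       (∀ y → Graph.Adj G u y → ¬ Graph.Adj G v y → y ≡ x)) →
    ¬ GroupVertexMagic G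
theorem2p2 G u v deg-u∸1≡deg-v (x , (u~x , _) , _) magic =
  parity-suc≢parity (deg G v) (begin
    parity (suc (deg G v))      ≡⟨ cong (λ k → parity (suc k)) (sym deg-u∸1≡deg-v) ⟩
    parity (suc (deg G u ∸ 1))  ≡⟨ cong parity (sym (neighbour⇒deg≡suc G u~x)) ⟩
    parity (deg G u)            ≡⟨ ℤ₂-vertexMagic⇒parity-deg-equal G (magic ℤ₂ ℤ₂-finite ℤ₂-nontrivial) u v ⟩
    parity (deg G v)            ∎)
  where open ≡-Reasoning
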